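{- Let $\mathbb{F}=\mathrm{GF}(2)$, let $k\le n$, and let $P\in\mathbb{F}^{m\times n}$ be a matrix such that every set of $k$ columns of $P$ is linearly independent over $\mathbb{F}$. Let $\mathbf{R}\in\mathbb{F}^{m\times m}$ be chosen uniformly at random. Then the random matrix $\mathbf{A}=P^\top\mathbf{R}P\in\mathbb{F}^{n\times n}$ (arithmetic over $\mathbb{F}$) is $k$-uniform.
   Context: A random matrix $\mathbf{A}\in\{0,1\}^{n\times n}$ is $k$-uniform if for every choice of $k$ rows and $k$ columns, the entries of the corresponding $k\times k$ submatrix are jointly uniformly distributed on $\{0,1\}^{k\times k}$. -}

module Defs where

open import Data.Nat using (ℕ; zero; suc; _^_; _*_)
open import Data.Bool using (Bool; true; false; _xor_; _∧_; if_then_else_)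
open import Data.Fin using (Fin; zero; suc)
open import Data.List using (List; []; _∷_; concatMap; map; length; filterᵇ)
open import Relation.Binary.PropositionalEquality using (_≡_)
open import Function.Definitions using (Injective)

-- GF(2) is modelled by Bool: addition = xor, multiplication = ∧.
-- A matrix over GF(2) with m rows and n columns.
Mat : ℕ → ℕ → Set
Mat m n = Fin m → Fin n → Bool

Σ₂ : {n : ℕ} → (Fin n → Bool) → Bool
Σ₂ {zero}  f = false
Σ₂ {suc n} f = f zero xor Σ₂ (λ i → f (suc i))

transpose : {m n : ℕ} → Mat m n → Mat n m
transpose M i j = M j i

_⊗_ : {m l n : ℕ} → Mat m l → Mat l n → Mat m n
(M ⊗ N) i j = Σ₂ (λ t → M i t ∧ N t j)

ColumnsIndependent : {m n k : ℕ} → Mat m n → (Fin k → Fin n) → Set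
ColumnsIndependent P c =
  (λc : Fin _ → Bool) →
  (∀ r → Σ₂ (λ i → λc i ∧ P r (c i)) ≡ false) →
  ∀ i → λc i ≡ false

-- Every set of k columns of P is linearly independent
-- (a set of k columns = an injective choice of k column indices).
EveryKColumnsIndependent : {m n : ℕ} → (k : ℕ) → Mat m n → Set
EveryKColumnsIndependent {n = n} k P =
  (c : Fin k → Fin n) → Injective _≡_ _≡_ c → ColumnsIndependent P c

allFuns : {A : Set} → List A → (n : ℕ) → List (Fin n → A)
allFuns xs zero    = (λ ()) ∷ []
allFuns xs (suc n) =
  concatMap (λ x → map (λ f → λ { zero → x ; (suc i) → f i }) (allFuns xs n)) xs

allBools : List Bool
allBools = false ∷ true ∷ []

-- The (finite, uniform) sample space of all m × n matrices over GF(2);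
-- it has exactly 2^(m*n) elements.
allMats : (m n : ℕ) → List (Mat m n)
allMats m n = allFuns (allFuns allBools n) m

_==_ : Bool → Bool → Bool
true  == b = b
false == b = if b then false else true

allᵇ : {n : ℕ} → (Fin n → Bool) → Bool
allᵇ {zero}  f = true
allᵇ {suc n} f = f zero ∧ allᵇ (λ i → f (suc i))

_≟M_ : {k l : ℕ} → Mat k l → Mat k l → Bool
M ≟M N = allᵇ (λ i → allᵇ (λ j → M i j == N i j))

count : {A : Set} → (A → Bool) → List A → ℕ
count p xs = length (filterᵇ p xs)

-- A random matrix given as a function 𝐀 : Mat m m → Mat n n of a uniformly
-- random R ∈ GF(2)^{m×m} is k-uniform if for every choice of k distinct rows
-- r and k distinct columns s, the k × k submatrix (𝐀 R)[r,s] is uniformly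
-- distributed on {0,1}^{k×k}: every B is attained with probability
-- 2^{-k²}, i.e. by exactly 2^{m²}/2^{k²} of the 2^{m²} outcomes R.
KUniform : {m n : ℕ} → (k : ℕ) → (Mat m m → Mat n n) → Set
KUniform {m} {n} k 𝐀 =
  (r s : Fin k → Fin n) → Injective _≡_ _≡_ r → Injective _≡_ _≡_ s →
  (B : Mat k k) →
  count (λ R → (λ i j → 𝐀 R (r i) (s j)) ≟M B) (allMats m m) * 2 ^ (k * k)
    ≡ 2 ^ (m * m)

-- Entry (i, j) of Pᵀ R P is the linear form R ↦ Σ_{t,u} P_{t,rᵢ} P_{u,sⱼ} R_{tu} in the m² entries
-- of R, whose coefficient matrix is the outer product of the columns rᵢ and sⱼ of P. Outer products
-- of two linearly independent families are linearly independent, so the entries of the k × k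
-- submatrix are k² independent linear forms in R. A system of K independent linear equations in N
-- unknowns over GF(2) has exactly 2^(N−K) solutions: eliminating the unknowns one at a time, either
-- no equation involves the current unknown (it is free and doubles the count) or some equation does,
-- and that pivot equation determines it and is used to eliminate it from the other equations.
module Submission where

open import Defs
open import Data.Nat using (ℕ; zero; suc; _+_; _*_; _^_; _≤_)
open import Data.Nat.Properties using (+-identityʳ; +-suc; *-assoc; *-commutativeSemigroup)
open import Data.Nat.ListAction using (sum)
open import Data.Nat.ListAction.Properties using (sum-++)
open import Data.Bool using (Bool; true; false; _xor_; _∧_; not)
open import Data.Bool.Properties
  using (_≟_; ¬-not; xor-assoc; xor-comm; xor-same; ∧-assoc; ∧-identityʳ; ∧-zeroʳ;
         ∧-distribˡ-xor; ∧-distribʳ-xor; ∧-commutativeMonoid; xor-∧-commutativeRing)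
open import Data.Fin using (Fin; zero; suc; punchIn; _↑ˡ_; _↑ʳ_; combine; remQuot; quotient; remainder)
open import Data.Fin.Properties using (any?; remQuot-combine; combine-remQuot)
open import Data.Vec.Functional using (insertAt) renaming (_∷_ to _∷ᶠ_)
open import Data.Vec.Functional.Properties using (insertAt-lookup; insertAt-punchIn)
open import Data.List using (List; []; _∷_; _++_; map; concatMap; cartesianProduct; length; filterᵇ)
open import Data.List.Properties using (filter-++; length-++; map-++; map-∘; map-cong; ++-identityʳ)
open import Data.Product using (_×_; _,_; proj₁; proj₂; uncurry; ∃)
open import Data.Sum using (_⊎_; inj₁; inj₂)
import Data.Sum as Sum
open import Function using (_∘_; id)
open import Relation.Nullary using (yes; no; contradiction)
open import Relation.Nullary.Decidable using (T?)
open import Relation.Binary.PropositionalEquality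
open import Algebra.Bundles using (CommutativeMonoid; CommutativeRing)
import Algebra.Properties.CommutativeSemigroup as CommutativeSemigroupProperties

private
  module Xor = CommutativeSemigroupProperties (CommutativeRing.+-commutativeSemigroup xor-∧-commutativeRing)
  module And = CommutativeSemigroupProperties (CommutativeMonoid.commutativeSemigroup ∧-commutativeMonoid)
  module Mul = CommutativeSemigroupProperties *-commutativeSemigroup

Σ₂-cong : {n : ℕ} {f g : Fin n → Bool} → (∀ i → f i ≡ g i) → Σ₂ f ≡ Σ₂ g
Σ₂-cong {zero}  _   = refl
Σ₂-cong {suc n} f≗g = cong₂ _xor_ (f≗g zero) (Σ₂-cong (f≗g ∘ suc))

Σ₂-zero : {n : ℕ} {f : Fin n → Bool} → (∀ i → f i ≡ false) → Σ₂ f ≡ false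
Σ₂-zero {zero}  _   = refl
Σ₂-zero {suc n} f≡0 = cong₂ _xor_ (f≡0 zero) (Σ₂-zero (f≡0 ∘ suc))

Σ₂-xor : {n : ℕ} (f g : Fin n → Bool) → Σ₂ (λ i → f i xor g i) ≡ Σ₂ f xor Σ₂ g
Σ₂-xor {zero}  f g = refl
Σ₂-xor {suc n} f g =
  trans (cong ((f zero xor g zero) xor_) (Σ₂-xor (f ∘ suc) (g ∘ suc)))
        (Xor.interchange (f zero) (g zero) (Σ₂ (f ∘ suc)) (Σ₂ (g ∘ suc)))

∧-distribˡ-Σ₂ : {n : ℕ} (x : Bool) (f : Fin n → Bool) → x ∧ Σ₂ f ≡ Σ₂ (λ i → x ∧ f i)
∧-distribˡ-Σ₂ {zero}  x f = ∧-zeroʳ x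
∧-distribˡ-Σ₂ {suc n} x f =
  trans (∧-distribˡ-xor x (f zero) (Σ₂ (f ∘ suc))) (cong ((x ∧ f zero) xor_) (∧-distribˡ-Σ₂ x (f ∘ suc)))

∧-distribʳ-Σ₂ : {n : ℕ} (x : Bool) (f : Fin n → Bool) → Σ₂ f ∧ x ≡ Σ₂ (λ i → f i ∧ x)
∧-distribʳ-Σ₂ {zero}  x f = refl
∧-distribʳ-Σ₂ {suc n} x f =
  trans (∧-distribʳ-xor x (f zero) (Σ₂ (f ∘ suc))) (cong ((f zero ∧ x) xor_) (∧-distribʳ-Σ₂ x (f ∘ suc)))

Σ₂-comm : {m n : ℕ} (f : Fin m → Fin n → Bool) →
          Σ₂ (λ i → Σ₂ (λ j → f i j)) ≡ Σ₂ (λ j → Σ₂ (λ i → f i j))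
Σ₂-comm {zero}  {n} f = sym (Σ₂-zero {n} (λ _ → refl))
Σ₂-comm {suc m}     f = trans (cong (Σ₂ (f zero) xor_) (Σ₂-comm (f ∘ suc))) (sym (Σ₂-xor (f zero) _))

Σ₂-remove : {n : ℕ} (p : Fin (suc n)) (f : Fin (suc n) → Bool) → Σ₂ f ≡ f p xor Σ₂ (f ∘ punchIn p)
Σ₂-remove         zero    f = refl
Σ₂-remove {suc n} (suc p) f =
  trans (cong (f zero xor_) (Σ₂-remove p (f ∘ suc))) (Xor.x∙yz≈y∙xz (f zero) (f (suc p)) _)

Σ₂-++ : {m n : ℕ} (f : Fin (m + n) → Bool) → Σ₂ f ≡ Σ₂ (f ∘ (_↑ˡ n)) xor Σ₂ (f ∘ (m ↑ʳ_))
Σ₂-++ {zero}  f = refl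
Σ₂-++ {suc m} f = trans (cong (f zero xor_) (Σ₂-++ {m} (f ∘ suc))) (sym (xor-assoc (f zero) _ _))

Σ₂-combine : {m n : ℕ} (f : Fin (m * n) → Bool) → Σ₂ f ≡ Σ₂ (λ i → Σ₂ (λ j → f (combine {m} {n} i j)))
Σ₂-combine {zero}      f = refl
Σ₂-combine {suc m} {n} f =
  trans (Σ₂-++ {n} f) (cong (Σ₂ (λ j → f (j ↑ˡ m * n)) xor_) (Σ₂-combine {m} (f ∘ (n ↑ʳ_))))

allᵇ-cong : {n : ℕ} {f g : Fin n → Bool} → (∀ i → f i ≡ g i) → allᵇ f ≡ allᵇ g
allᵇ-cong {zero}  _   = refl
allᵇ-cong {suc n} f≗g = cong₂ _∧_ (f≗g zero) (allᵇ-cong (f≗g ∘ suc))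

allᵇ-remove : {n : ℕ} (p : Fin (suc n)) (f : Fin (suc n) → Bool) → allᵇ f ≡ f p ∧ allᵇ (f ∘ punchIn p)
allᵇ-remove         zero    f = refl
allᵇ-remove {suc n} (suc p) f =
  trans (cong (f zero ∧_) (allᵇ-remove p (f ∘ suc))) (And.x∙yz≈y∙xz (f zero) (f (suc p)) _)

allᵇ-++ : {m n : ℕ} (f : Fin (m + n) → Bool) → allᵇ f ≡ allᵇ (f ∘ (_↑ˡ n)) ∧ allᵇ (f ∘ (m ↑ʳ_))
allᵇ-++ {zero}  f = refl
allᵇ-++ {suc m} f = trans (cong (f zero ∧_) (allᵇ-++ {m} (f ∘ suc))) (sym (∧-assoc (f zero) _ _))

allᵇ-combine : {m n : ℕ} (f : Fin (m * n) → Bool) → allᵇ f ≡ allᵇ (λ i → allᵇ (λ j → f (combine {m} {n} i j)))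
allᵇ-combine {zero}      f = refl
allᵇ-combine {suc m} {n} f =
  trans (allᵇ-++ {n} f) (cong (allᵇ (λ j → f (j ↑ˡ m * n)) ∧_) (allᵇ-combine {m} (f ∘ (n ↑ʳ_))))

==⇒≡ : {x y : Bool} → (x == y) ≡ true → x ≡ y
==⇒≡ {false} {false} _ = refl
==⇒≡ {true}  {true}  _ = refl

==-xorʳ : ∀ x y z → ((x xor z) == (y xor z)) ≡ (x == y)
==-xorʳ false false false = refl
==-xorʳ false false true  = refl
==-xorʳ false true  false = refl
==-xorʳ false true  true  = refl
==-xorʳ true  false false = refl
==-xorʳ true  false true  = refl
==-xorʳ true  true  false = refl
==-xorʳ true  true  true  = refl

not-== : ∀ x y → (not x == y) ≡ not (x == y)
not-== false false = refl
not-== false true  = refl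
not-== true  false = refl
not-== true  true  = refl

∧-congˡ-true : {b x y : Bool} → (b ≡ true → x ≡ y) → b ∧ x ≡ b ∧ y
∧-congˡ-true {false} _   = refl
∧-congˡ-true {true}  x≡y = x≡y refl

count-cong : {A : Set} {p q : A → Bool} → (∀ x → p x ≡ q x) → ∀ xs → count p xs ≡ count q xs
count-cong p≗q []                       = refl
count-cong {p = p} {q} p≗q (x ∷ xs) rewrite p≗q x with q x
... | true  = cong suc (count-cong p≗q xs)
... | false = count-cong p≗q xs

count-++ : {A : Set} (p : A → Bool) (xs ys : List A) → count p (xs ++ ys) ≡ count p xs + count p ys
count-++ p xs ys = trans (cong length (filter-++ (T? ∘ p) xs ys)) (length-++ (filterᵇ p xs))

count-map : {A B : Set} (p : B → Bool) (f : A → B) (xs : List A) → count p (map f xs) ≡ count (p ∘ f) xs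
count-map p f []       = refl
count-map p f (x ∷ xs) with p (f x)
... | true  = cong suc (count-map p f xs)
... | false = count-map p f xs

count-concatMap : {A B : Set} (p : B → Bool) (f : A → List B) (xs : List A) →
  count p (concatMap f xs) ≡ sum (map (count p ∘ f) xs)
count-concatMap p f []       = refl
count-concatMap p f (x ∷ xs) =
  trans (count-++ p (f x) (concatMap f xs)) (cong (count p (f x) +_) (count-concatMap p f xs))

count-cartesianProduct : {A B : Set} (p : A × B → Bool) (xs : List A) (ys : List B) →
  count p (cartesianProduct xs ys) ≡ sum (map (λ x → count (λ y → p (x , y)) ys) xs)
count-cartesianProduct p []       ys = refl
count-cartesianProduct p (x ∷ xs) ys =
  trans (count-++ p (map (x ,_) ys) (cartesianProduct xs ys))
        (cong₂ _+_ (count-map p (x ,_) ys) (count-cartesianProduct p xs ys))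

count-∧-not : {A : Set} (d h : A → Bool) (xs : List A) →
  count (λ x → d x ∧ h x) xs + count (λ x → not (d x) ∧ h x) xs ≡ count h xs
count-∧-not d h []       = refl
count-∧-not d h (x ∷ xs) with d x | h x
... | true  | true  = cong suc (count-∧-not d h xs)
... | false | true  = trans (+-suc _ _) (cong suc (count-∧-not d h xs))
... | true  | false = count-∧-not d h xs
... | false | false = count-∧-not d h xs

sum-map-++-map : {A B : Set} (φ : B → ℕ) (g₀ g₁ : A → B) (xs : List A) →
  sum (map φ (map g₀ xs ++ (map g₁ xs ++ []))) ≡ sum (map (φ ∘ g₀) xs) + sum (map (φ ∘ g₁) xs)
sum-map-++-map φ g₀ g₁ xs = begin
  sum (map φ (map g₀ xs ++ (map g₁ xs ++ [])))
    ≡⟨ cong sum (map-++ φ (map g₀ xs) (map g₁ xs ++ [])) ⟩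
  sum (map φ (map g₀ xs) ++ map φ (map g₁ xs ++ []))
    ≡⟨ sum-++ (map φ (map g₀ xs)) _ ⟩
  sum (map φ (map g₀ xs)) + sum (map φ (map g₁ xs ++ []))
    ≡⟨ cong₂ (λ ys zs → sum ys + sum zs) (sym (map-∘ xs)) (trans (cong (map φ) (++-identityʳ _)) (sym (map-∘ xs))) ⟩
  sum (map (φ ∘ g₀) xs) + sum (map (φ ∘ g₁) xs) ∎
  where open ≡-Reasoning

-- Linear independence over GF(2)

-- ColumnsIndependent P c is by definition LinearlyIndependent (λ i r → P r (c i)).
LinearlyIndependent : {C : Set} {K : ℕ} → (Fin K → C → Bool) → Set
LinearlyIndependent {C} {K} F =
  (c : Fin K → Bool) → (∀ κ → Σ₂ (λ q → c q ∧ F q κ) ≡ false) → ∀ q → c q ≡ false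

independent-reindex : {C C′ : Set} {K : ℕ} {F : Fin K → C → Bool} (g : C′ → C) →
  (∀ κ → (∃ λ κ′ → g κ′ ≡ κ) ⊎ (∀ q → F q κ ≡ false)) →
  LinearlyIndependent F → LinearlyIndependent (λ q → F q ∘ g)
independent-reindex {F = F} g covered indep c c·F∘g≡0 = indep c c·F≡0
  where
  c·F≡0 : ∀ κ → Σ₂ (λ q → c q ∧ F q κ) ≡ false
  c·F≡0 κ with covered κ
  ... | inj₁ (κ′ , refl) = c·F∘g≡0 κ′
  ... | inj₂ F≡0         = Σ₂-zero (λ q → trans (cong (c q ∧_) (F≡0 q)) (∧-zeroʳ (c q)))

reduce : {K : ℕ} (p : Fin (suc K)) (a : Fin K → Bool) (v : Fin (suc K) → Bool) → Fin K → Bool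
reduce p a v j = v (punchIn p j) xor (a j ∧ v p)

reduceForms : {C : Set} {K : ℕ} (p : Fin (suc K)) (a : Fin K → Bool) →
              (Fin (suc K) → C → Bool) → Fin K → C → Bool
reduceForms p a F j κ = reduce p a (λ q → F q κ) j

combination-reduce : {K : ℕ} (p : Fin (suc K)) (a c : Fin K → Bool) (v : Fin (suc K) → Bool) →
  Σ₂ (λ q → insertAt c p (Σ₂ (λ j → c j ∧ a j)) q ∧ v q) ≡ Σ₂ (λ j → c j ∧ reduce p a v j)
combination-reduce p a c v = begin
  Σ₂ (λ q → c′ q ∧ v q)
    ≡⟨ Σ₂-remove p (λ q → c′ q ∧ v q) ⟩
  (c′ p ∧ v p) xor Σ₂ (λ j → c′ (punchIn p j) ∧ v (punchIn p j))
    ≡⟨ cong₂ (λ x y → (x ∧ v p) xor y) (insertAt-lookup c p μ)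
             (Σ₂-cong (λ j → cong (_∧ v (punchIn p j)) (insertAt-punchIn c p μ j))) ⟩
  (μ ∧ v p) xor Σ₂ (λ j → c j ∧ v (punchIn p j))
    ≡⟨ xor-comm (μ ∧ v p) _ ⟩
  Σ₂ (λ j → c j ∧ v (punchIn p j)) xor (μ ∧ v p)
    ≡⟨ cong (Σ₂ (λ j → c j ∧ v (punchIn p j)) xor_) (∧-distribʳ-Σ₂ (v p) (λ j → c j ∧ a j)) ⟩
  Σ₂ (λ j → c j ∧ v (punchIn p j)) xor Σ₂ (λ j → (c j ∧ a j) ∧ v p)
    ≡⟨ Σ₂-xor (λ j → c j ∧ v (punchIn p j)) (λ j → (c j ∧ a j) ∧ v p) ⟨
  Σ₂ (λ j → (c j ∧ v (punchIn p j)) xor ((c j ∧ a j) ∧ v p))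
    ≡⟨ Σ₂-cong (λ j → trans (cong ((c j ∧ v (punchIn p j)) xor_) (∧-assoc (c j) (a j) (v p)))
                            (sym (∧-distribˡ-xor (c j) (v (punchIn p j)) (a j ∧ v p)))) ⟩
  Σ₂ (λ j → c j ∧ reduce p a v j) ∎
  where
  open ≡-Reasoning
  μ = Σ₂ (λ j → c j ∧ a j)
  c′ = insertAt c p μ

independent-reduce : {C : Set} {K : ℕ} {F : Fin (suc K) → C → Bool} (p : Fin (suc K)) (a : Fin K → Bool) →
  LinearlyIndependent F → LinearlyIndependent (reduceForms p a F)
independent-reduce {F = F} p a indep c c·G≡0 j =
  trans (sym (insertAt-punchIn c p μ j))
        (indep (insertAt c p μ) (λ κ → trans (combination-reduce p a c (λ q → F q κ)) (c·G≡0 κ)) (punchIn p j))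
  where
  μ = Σ₂ (λ j → c j ∧ a j)

kronecker : {A B : Set} {k l : ℕ} → (Fin k → A → Bool) → (Fin l → B → Bool) → Fin (k * l) → A × B → Bool
kronecker {k = k} {l} u v τ (x , y) = u (quotient {k} l τ) x ∧ v (remainder {k} l τ) y

kronecker-combine : {A B : Set} {k l : ℕ} (u : Fin k → A → Bool) (v : Fin l → B → Bool) (i : Fin k) (j : Fin l) →
  ∀ x y → kronecker u v (combine i j) (x , y) ≡ u i x ∧ v j y
kronecker-combine {l = l} u v i j x y = cong (λ ij → u (proj₁ ij) x ∧ v (proj₂ ij) y) (remQuot-combine {k = l} i j)

kronecker-independent : {A B : Set} {k l : ℕ} {u : Fin k → A → Bool} {v : Fin l → B → Bool} →
  LinearlyIndependent u → LinearlyIndependent v → LinearlyIndependent (kronecker u v)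
kronecker-independent {k = k} {l} {u} {v} u-indep v-indep c c·F≡0 τ =
  trans (cong c (sym (combine-remQuot {k} l τ))) (c′≡0 (quotient {k} l τ) (remainder {k} l τ))
  where
  c′ : Fin k → Fin l → Bool
  c′ i j = c (combine i j)
  regroup : ∀ x y → Σ₂ (λ τ → c τ ∧ kronecker u v τ (x , y)) ≡ Σ₂ (λ j → Σ₂ (λ i → c′ i j ∧ u i x) ∧ v j y)
  regroup x y = begin
    Σ₂ (λ τ → c τ ∧ kronecker u v τ (x , y))
      ≡⟨ Σ₂-combine {k} (λ τ → c τ ∧ kronecker u v τ (x , y)) ⟩
    Σ₂ (λ i → Σ₂ (λ j → c′ i j ∧ kronecker u v (combine i j) (x , y)))
      ≡⟨ Σ₂-cong (λ i → Σ₂-cong (λ j → cong (c′ i j ∧_) (kronecker-combine u v i j x y))) ⟩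
    Σ₂ (λ i → Σ₂ (λ j → c′ i j ∧ (u i x ∧ v j y)))
      ≡⟨ Σ₂-comm (λ i j → c′ i j ∧ (u i x ∧ v j y)) ⟩
    Σ₂ (λ j → Σ₂ (λ i → c′ i j ∧ (u i x ∧ v j y)))
      ≡⟨ Σ₂-cong (λ j → trans (Σ₂-cong (λ i → sym (∧-assoc (c′ i j) (u i x) (v j y))))
                              (sym (∧-distribʳ-Σ₂ (v j y) (λ i → c′ i j ∧ u i x)))) ⟩
    Σ₂ (λ j → Σ₂ (λ i → c′ i j ∧ u i x) ∧ v j y) ∎
    where open ≡-Reasoning
  c′≡0 : ∀ i j → c′ i j ≡ false
  c′≡0 i j = u-indep (λ i → c′ i j)
    (λ x → v-indep (λ j → Σ₂ (λ i → c′ i j ∧ u i x)) (λ y → trans (sym (regroup x y)) (c·F≡0 (x , y))) j) i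

-- Linear equations in the entries of a partially filled matrix

-- The unknowns are l free bits followed by the entries of an a × b matrix. Once the free bits are
-- used up, the first row of the matrix becomes the next l = b free bits (liftRow), which matches
-- the way allMats enumerates matrices row by row.
Vars : ℕ → ℕ → ℕ → Set
Vars l a b = Fin l ⊎ (Fin a × Fin b)

Assignment : ℕ → ℕ → ℕ → Set
Assignment l a b = (Fin l → Bool) × Mat a b

assignments : (l a b : ℕ) → List (Assignment l a b)
assignments l a b = cartesianProduct (allFuns allBools l) (allMats a b)

value : {l a b : ℕ} → Assignment l a b → Vars l a b → Bool
value x (inj₁ t)       = proj₁ x t
value x (inj₂ (i , j)) = proj₂ x i j

Σᴹ : {a b : ℕ} → (Fin a × Fin b → Bool) → Bool
Σᴹ f = Σ₂ (λ i → Σ₂ (λ j → f (i , j)))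

Σᵛ : {l a b : ℕ} → (Vars l a b → Bool) → Bool
Σᵛ f = Σ₂ (f ∘ inj₁) xor Σᴹ (f ∘ inj₂)

eval : {l a b : ℕ} → (Vars l a b → Bool) → Assignment l a b → Bool
eval u x = Σᵛ (λ κ → u κ ∧ value x κ)

Solves : {l a b K : ℕ} → (Fin K → Vars l a b → Bool) → (Fin K → Bool) → Assignment l a b → Bool
Solves F β x = allᵇ (λ q → eval (F q) x == β q)

shift : {l a b : ℕ} → Vars l a b → Vars (suc l) a b
shift = Sum.map suc id

_∷ᵃ_ : {l a b : ℕ} → Bool → Assignment l a b → Assignment (suc l) a b
c ∷ᵃ x = (c ∷ᶠ proj₁ x) , proj₂ x

liftRow : {a b : ℕ} → Vars b a b → Vars 0 (suc a) b
liftRow (inj₁ j)       = inj₂ (zero , j)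
liftRow (inj₂ (i , j)) = inj₂ (suc i , j)

Σᴹ-cong : {a b : ℕ} {f g : Fin a × Fin b → Bool} → (∀ ij → f ij ≡ g ij) → Σᴹ f ≡ Σᴹ g
Σᴹ-cong f≗g = Σ₂-cong (λ i → Σ₂-cong (λ j → f≗g (i , j)))

Σᴹ-xor : {a b : ℕ} (f g : Fin a × Fin b → Bool) → Σᴹ (λ ij → f ij xor g ij) ≡ Σᴹ f xor Σᴹ g
Σᴹ-xor f g = trans (Σ₂-cong (λ i → Σ₂-xor (λ j → f (i , j)) (λ j → g (i , j))))
                   (Σ₂-xor (λ i → Σ₂ (λ j → f (i , j))) (λ i → Σ₂ (λ j → g (i , j))))

∧-distribˡ-Σᴹ : {a b : ℕ} (x : Bool) (f : Fin a × Fin b → Bool) → x ∧ Σᴹ f ≡ Σᴹ (λ ij → x ∧ f ij)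
∧-distribˡ-Σᴹ x f = trans (∧-distribˡ-Σ₂ x (λ i → Σ₂ (λ j → f (i , j))))
                          (Σ₂-cong (λ i → ∧-distribˡ-Σ₂ x (λ j → f (i , j))))

Σᵛ-cong : {l a b : ℕ} {f g : Vars l a b → Bool} → (∀ κ → f κ ≡ g κ) → Σᵛ f ≡ Σᵛ g
Σᵛ-cong f≗g = cong₂ _xor_ (Σ₂-cong (f≗g ∘ inj₁)) (Σᴹ-cong (f≗g ∘ inj₂))

Σᵛ-xor : {l a b : ℕ} (f g : Vars l a b → Bool) → Σᵛ (λ κ → f κ xor g κ) ≡ Σᵛ f xor Σᵛ g
Σᵛ-xor f g =
  trans (cong₂ _xor_ (Σ₂-xor (f ∘ inj₁) (g ∘ inj₁)) (Σᴹ-xor (f ∘ inj₂) (g ∘ inj₂)))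
        (Xor.interchange (Σ₂ (f ∘ inj₁)) (Σ₂ (g ∘ inj₁)) (Σᴹ (f ∘ inj₂)) (Σᴹ (g ∘ inj₂)))

∧-distribˡ-Σᵛ : {l a b : ℕ} (x : Bool) (f : Vars l a b → Bool) → x ∧ Σᵛ f ≡ Σᵛ (λ κ → x ∧ f κ)
∧-distribˡ-Σᵛ x f =
  trans (∧-distribˡ-xor x (Σ₂ (f ∘ inj₁)) (Σᴹ (f ∘ inj₂)))
        (cong₂ _xor_ (∧-distribˡ-Σ₂ x (f ∘ inj₁)) (∧-distribˡ-Σᴹ x (f ∘ inj₂)))

Σᵛ-shift : {l a b : ℕ} (f : Vars (suc l) a b → Bool) → Σᵛ f ≡ f (inj₁ zero) xor Σᵛ (f ∘ shift)
Σᵛ-shift f = xor-assoc (f (inj₁ zero)) _ _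

eval-linear : {l a b : ℕ} (u w : Vars l a b → Bool) (s : Bool) (x : Assignment l a b) →
  eval (λ κ → u κ xor (s ∧ w κ)) x ≡ eval u x xor (s ∧ eval w x)
eval-linear u w s x = begin
  Σᵛ (λ κ → (u κ xor (s ∧ w κ)) ∧ value x κ)
    ≡⟨ Σᵛ-cong (λ κ → trans (∧-distribʳ-xor (value x κ) (u κ) (s ∧ w κ))
                            (cong ((u κ ∧ value x κ) xor_) (∧-assoc s (w κ) (value x κ)))) ⟩
  Σᵛ (λ κ → (u κ ∧ value x κ) xor (s ∧ (w κ ∧ value x κ)))
    ≡⟨ Σᵛ-xor (λ κ → u κ ∧ value x κ) (λ κ → s ∧ (w κ ∧ value x κ)) ⟩
  eval u x xor Σᵛ (λ κ → s ∧ (w κ ∧ value x κ))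
    ≡⟨ cong (eval u x xor_) (∧-distribˡ-Σᵛ s (λ κ → w κ ∧ value x κ)) ⟨
  eval u x xor (s ∧ eval w x) ∎
  where open ≡-Reasoning

eval-∷ : {l a b : ℕ} (u : Vars (suc l) a b → Bool) (c : Bool) (x : Assignment l a b) →
  eval u (c ∷ᵃ x) ≡ (u (inj₁ zero) ∧ c) xor eval (u ∘ shift) x
eval-∷ u c x = Σᵛ-shift (λ κ → u κ ∧ value (c ∷ᵃ x) κ)

solves-reduce : {l a b K : ℕ} (F : Fin (suc K) → Vars l a b → Bool) (β : Fin (suc K) → Bool)
  (p : Fin (suc K)) (a′ : Fin K → Bool) (x : Assignment l a b) →
  Solves F β x ≡ (eval (F p) x == β p) ∧ Solves (reduceForms p a′ F) (reduce p a′ β) x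
solves-reduce F β p a′ x =
  trans (allᵇ-remove p (λ q → eval (F q) x == β q))
        (∧-congˡ-true (λ Fp·x≡βp → allᵇ-cong (λ j → sym (reduced-equation j (==⇒≡ Fp·x≡βp)))))
  where
  reduced-equation : ∀ j → eval (F p) x ≡ β p →
    (eval (reduceForms p a′ F j) x == reduce p a′ β j) ≡ (eval (F (punchIn p j)) x == β (punchIn p j))
  reduced-equation j Fp·x≡βp = begin
    eval (reduceForms p a′ F j) x == reduce p a′ β j
      ≡⟨ cong (_== reduce p a′ β j) (eval-linear (F (punchIn p j)) (F p) (a′ j) x) ⟩
    (eval (F (punchIn p j)) x xor (a′ j ∧ eval (F p) x)) == reduce p a′ β j
      ≡⟨ cong (λ e → (eval (F (punchIn p j)) x xor (a′ j ∧ e)) == reduce p a′ β j) Fp·x≡βp ⟩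
    (eval (F (punchIn p j)) x xor (a′ j ∧ β p)) == (β (punchIn p j) xor (a′ j ∧ β p))
      ≡⟨ ==-xorʳ (eval (F (punchIn p j)) x) (β (punchIn p j)) (a′ j ∧ β p) ⟩
    eval (F (punchIn p j)) x == β (punchIn p j) ∎
    where open ≡-Reasoning

solves-∷-free : {l a b K : ℕ} (F : Fin K → Vars (suc l) a b → Bool) (β : Fin K → Bool) →
  (∀ q → F q (inj₁ zero) ≡ false) → ∀ c x → Solves F β (c ∷ᵃ x) ≡ Solves (λ q → F q ∘ shift) β x
solves-∷-free F β free c x = allᵇ-cong (λ q → cong (_== β q)
  (trans (eval-∷ (F q) c x) (cong (λ α → (α ∧ c) xor eval (F q ∘ shift) x) (free q))))

independent-shift : {l a b K : ℕ} {F : Fin K → Vars (suc l) a b → Bool} →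
  (∀ q → F q (inj₁ zero) ≡ false) → LinearlyIndependent F → LinearlyIndependent (λ q → F q ∘ shift)
independent-shift {F = F} free = independent-reindex shift covered
  where
  covered : ∀ κ → (∃ λ κ′ → shift κ′ ≡ κ) ⊎ (∀ q → F q κ ≡ false)
  covered (inj₁ zero)    = inj₂ free
  covered (inj₁ (suc t)) = inj₁ (inj₁ t , refl)
  covered (inj₂ ij)      = inj₁ (inj₂ ij , refl)

-- These two hold only for Solves: allFuns prepends a value with its own pattern lambda, which agrees
-- with _∷ᶠ_ (resp. the row split of liftRow) only after Solves has evaluated the assignment.
count-solves-∷ : {l a b K : ℕ} (F : Fin K → Vars (suc l) a b → Bool) (β : Fin K → Bool) →
  count (Solves F β) (assignments (suc l) a b)
    ≡ count (Solves F β ∘ (false ∷ᵃ_)) (assignments l a b) + count (Solves F β ∘ (true ∷ᵃ_)) (assignments l a b)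
count-solves-∷ {l} {a} {b} F β =
  trans (count-cartesianProduct (Solves F β) (allFuns allBools (suc l)) (allMats a b))
  (trans (sum-map-++-map (λ v → count (λ M → Solves F β (v , M)) (allMats a b)) _ _ (allFuns allBools l))
         (sym (cong₂ _+_ (count-cartesianProduct _ (allFuns allBools l) (allMats a b))
                         (count-cartesianProduct _ (allFuns allBools l) (allMats a b)))))

count-solves-row : {a b K : ℕ} (F : Fin K → Vars 0 (suc a) b → Bool) (β : Fin K → Bool) →
  count (Solves F β) (assignments 0 (suc a) b) ≡ count (Solves (λ q → F q ∘ liftRow) β) (assignments b a b)
count-solves-row {a} {b} F β =
  trans (count-cartesianProduct (Solves F β) (allFuns allBools 0) (allMats (suc a) b))
  (trans (+-identityʳ _)
  (trans (count-concatMap _ _ (allFuns allBools b))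
  (trans (cong sum (map-cong (λ row → count-map _ _ (allMats a b)) (allFuns allBools b)))
         (sym (count-cartesianProduct _ (allFuns allBools b) (allMats a b))))))

-- The number of solutions

SolutionCount : ℕ → ℕ → ℕ → Set
SolutionCount l a b =
  ∀ {K} (F : Fin K → Vars l a b → Bool) (β : Fin K → Bool) → LinearlyIndependent F →
  count (Solves F β) (assignments l a b) * 2 ^ K ≡ 2 ^ (l + a * b)

solutionCount-empty : {b : ℕ} → SolutionCount 0 0 b
solutionCount-empty {K = zero}  F β _     = refl
solutionCount-empty {K = suc K} F β indep =
  contradiction (indep (λ _ → true) (λ { (inj₁ ()) ; (inj₂ (() , _)) }) zero) λ ()

solutionCount-row : {a b : ℕ} → SolutionCount b a b → SolutionCount 0 (suc a) b
solutionCount-row IH {K} F β indep =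
  trans (cong (_* 2 ^ K) (count-solves-row F β))
        (IH (λ q → F q ∘ liftRow) β (independent-reindex liftRow covered indep))
  where
  covered : ∀ κ → (∃ λ κ′ → liftRow κ′ ≡ κ) ⊎ (∀ q → F q κ ≡ false)
  covered (inj₂ (zero , j))  = inj₁ (inj₁ j , refl)
  covered (inj₂ (suc i , j)) = inj₁ (inj₂ (i , j) , refl)

solutionCount-free : {l a b K : ℕ} → SolutionCount l a b →
  (F : Fin K → Vars (suc l) a b → Bool) (β : Fin K → Bool) → LinearlyIndependent F →
  (∀ q → F q (inj₁ zero) ≡ false) → count (Solves F β) (assignments (suc l) a b) * 2 ^ K ≡ 2 ^ (suc l + a * b)
solutionCount-free {l} {a} {b} {K} IH F β indep free = begin
  count (Solves F β) (assignments (suc l) a b) * 2 ^ K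
    ≡⟨ cong (_* 2 ^ K) (trans (count-solves-∷ F β) (cong₂ _+_ (count-cong (solves-∷-free F β free false) xs)
                                                              (count-cong (solves-∷-free F β free true) xs))) ⟩
  (N + N) * 2 ^ K     ≡⟨ cong (λ m → (N + m) * 2 ^ K) (+-identityʳ N) ⟨
  2 * N * 2 ^ K       ≡⟨ *-assoc 2 N (2 ^ K) ⟩
  2 * (N * 2 ^ K)     ≡⟨ cong (2 *_) (IH (λ q → F q ∘ shift) β (independent-shift free indep)) ⟩
  2 * 2 ^ (l + a * b) ∎
  where
  open ≡-Reasoning
  xs = assignments l a b
  N  = count (Solves (λ q → F q ∘ shift) β) xs

solutionCount-pivot : {l a b K : ℕ} → SolutionCount l a b →
  (F : Fin (suc K) → Vars (suc l) a b → Bool) (β : Fin (suc K) → Bool) → LinearlyIndependent F →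
  (p : Fin (suc K)) → F p (inj₁ zero) ≡ true →
  count (Solves F β) (assignments (suc l) a b) * 2 ^ suc K ≡ 2 ^ (suc l + a * b)
solutionCount-pivot {l} {a} {b} {K} IH F β indep p pivot = begin
  count (Solves F β) (assignments (suc l) a b) * 2 ^ suc K
    ≡⟨ cong (_* 2 ^ suc K) (trans (count-solves-∷ F β) one-value-per-solution) ⟩
  N * (2 * 2 ^ K)     ≡⟨ Mul.x∙yz≈y∙xz N 2 (2 ^ K) ⟩
  2 * (N * 2 ^ K)     ≡⟨ cong (2 *_) (IH G′ γ (independent-shift reduced-free (independent-reduce {F = F} p a′ indep))) ⟩
  2 * 2 ^ (l + a * b) ∎
  where
  open ≡-Reasoning
  xs = assignments l a b
  a′ : Fin K → Bool
  a′ j = F (punchIn p j) (inj₁ zero)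
  G = reduceForms p a′ F
  γ = reduce p a′ β
  G′ = λ j → G j ∘ shift
  N = count (Solves G′ γ) xs
  reduced-free : ∀ j → G j (inj₁ zero) ≡ false
  reduced-free j = trans (cong (λ α → a′ j xor (a′ j ∧ α)) pivot)
                         (trans (cong (a′ j xor_) (∧-identityʳ (a′ j))) (xor-same (a′ j)))
  pivot-equation : Assignment l a b → Bool
  pivot-equation x = eval (F p ∘ shift) x == β p
  solves-∷ : ∀ c x → Solves F β (c ∷ᵃ x) ≡ ((c xor eval (F p ∘ shift) x) == β p) ∧ Solves G′ γ x
  solves-∷ c x =
    trans (solves-reduce F β p a′ (c ∷ᵃ x))
          (cong₂ _∧_ (cong (_== β p) (trans (eval-∷ (F p) c x) (cong (λ α → (α ∧ c) xor eval (F p ∘ shift) x) pivot)))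
                     (solves-∷-free G γ reduced-free c x))
  one-value-per-solution : count (Solves F β ∘ (false ∷ᵃ_)) xs + count (Solves F β ∘ (true ∷ᵃ_)) xs ≡ N
  one-value-per-solution =
    trans (cong₂ _+_ (count-cong (solves-∷ false) xs)
                     (count-cong (λ x → trans (solves-∷ true x)
                                              (cong (_∧ Solves G′ γ x) (not-== (eval (F p ∘ shift) x) (β p)))) xs))
          (count-∧-not pivot-equation (Solves G′ γ) xs)

solutionCount-suc : {l a b : ℕ} → SolutionCount l a b → SolutionCount (suc l) a b
solutionCount-suc IH {zero}  F β indep = solutionCount-free IH F β indep (λ ())
solutionCount-suc IH {suc K} F β indep with any? (λ q → F q (inj₁ zero) ≟ true)
... | yes (p , pivot) = solutionCount-pivot IH F β indep p pivot
... | no  noPivot     = solutionCount-free IH F β indep (λ q → ¬-not (noPivot ∘ (q ,_)))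

count-solutions : (l a b : ℕ) → SolutionCount l a b
count-solutions zero    zero    b = solutionCount-empty
count-solutions zero    (suc a) b = solutionCount-row (count-solutions b a b)
count-solutions (suc l) a       b = solutionCount-suc (count-solutions l a b)

matrixForm : {a b : ℕ} → (Fin a × Fin b → Bool) → Vars 0 a b → Bool
matrixForm f (inj₂ ij) = f ij

count-matrix-solutions : {a b K : ℕ} (F : Fin K → Fin a × Fin b → Bool) (β : Fin K → Bool) →
  LinearlyIndependent F →
  count (λ M → Solves (matrixForm ∘ F) β ((λ ()) , M)) (allMats a b) * 2 ^ K ≡ 2 ^ (a * b)
count-matrix-solutions {a} {b} {K} F β indep =
  trans (cong (_* 2 ^ K) (sym (trans (count-cartesianProduct _ (allFuns allBools 0) (allMats a b)) (+-identityʳ _))))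
        (count-solutions 0 a b (matrixForm ∘ F) β (λ c c·F≡0 → indep c (c·F≡0 ∘ inj₂)))

-- The submatrices of Pᵀ R Q

bilinear-entry : {m m′ n n′ : ℕ} (P : Mat m n) (R : Mat m m′) (Q : Mat m′ n′) (x : Fin n) (y : Fin n′) →
  ((transpose P ⊗ R) ⊗ Q) x y ≡ Σᴹ (λ { (t , u) → (P t x ∧ Q u y) ∧ R t u })
bilinear-entry P R Q x y = begin
  Σ₂ (λ u → Σ₂ (λ t → P t x ∧ R t u) ∧ Q u y)   ≡⟨ Σ₂-cong (λ u → ∧-distribʳ-Σ₂ (Q u y) (λ t → P t x ∧ R t u)) ⟩
  Σ₂ (λ u → Σ₂ (λ t → (P t x ∧ R t u) ∧ Q u y)) ≡⟨ Σ₂-comm (λ t u → (P t x ∧ R t u) ∧ Q u y) ⟨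
  Σ₂ (λ t → Σ₂ (λ u → (P t x ∧ R t u) ∧ Q u y)) ≡⟨ Σ₂-cong (λ t → Σ₂-cong (λ u → And.xy∙z≈xz∙y (P t x) (R t u) (Q u y))) ⟩
  Σ₂ (λ t → Σ₂ (λ u → (P t x ∧ Q u y) ∧ R t u)) ∎
  where open ≡-Reasoning

submatrix-equations : {m m′ n n′ k l : ℕ} (P : Mat m n) (R : Mat m m′) (Q : Mat m′ n′)
  (r : Fin k → Fin n) (s : Fin l → Fin n′) (B : Mat k l) →
  Solves (matrixForm ∘ kronecker (λ i t → P t (r i)) (λ j u → Q u (s j))) (λ τ → uncurry B (remQuot l τ)) ((λ ()) , R)
    ≡ ((λ i j → ((transpose P ⊗ R) ⊗ Q) (r i) (s j)) ≟M B)
submatrix-equations {k = k} {l} P R Q r s B =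
  trans (allᵇ-combine {k} {l} _)
        (allᵇ-cong (λ i → allᵇ-cong (λ j → cong₂ _==_ (entry i j) (cong (uncurry B) (remQuot-combine {k = l} i j)))))
  where
  entry : ∀ i j → Σᴹ (λ { (t , u) → kronecker (λ i t → P t (r i)) (λ j u → Q u (s j)) (combine i j) (t , u) ∧ R t u })
                  ≡ ((transpose P ⊗ R) ⊗ Q) (r i) (s j)
  entry i j = trans (Σᴹ-cong (λ { (t , u) → cong (_∧ R t u) (kronecker-combine (λ i t → P t (r i)) (λ j u → Q u (s j)) i j t u) }))
                    (sym (bilinear-entry P R Q (r i) (s j)))

lemma15 : (m n k : ℕ) → k ≤ n → (P : Mat m n) →
    EveryKColumnsIndependent k P →
    KUniform k (λ R → (transpose P ⊗ R) ⊗ P)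
lemma15 m n k _ P indep r s r-inj s-inj B =
  trans (cong (_* 2 ^ (k * k)) (count-cong (λ R → sym (submatrix-equations P R P r s B)) (allMats m m)))
        (count-matrix-solutions _ _ (kronecker-independent (indep r r-inj) (indep s s-inj)))
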